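{- Let $H$ be a digraph (possibly with loops), $D$ an $H$-colored digraph, and $\mathscr{F}$ a walk-preservative $H$-class partition of $A(D)$ such that for every $F\in\mathscr{F}$, $D\langle F\rangle$ is unilateral and has no sinks. If $C_{\mathscr{F}}(D)$ has a $(k,l)$-kernel for some $k\geq 3$ and $l\geq 1$, then $D$ has a $(k-1,l+1,H)$-kernel by walks.
   Context: An $H$-colored digraph is a finite digraph $D$ without loops with a coloring $\rho:A(D)\to V(H)$. For $F\subseteq A(D)$, $D\langle F\rangle$ is the digraph with arc set $F$ and vertex set the vertices incident with an arc of $F$. An $H$-class partition of $A(D)$ is a partition $\mathscr{F}$ of $A(D)$ such that for all arcs $(u,v),(v,w)$ of $D$, $(\rho(u,v),\rho(v,w))\in A(H)$ iff some $F\in\mathscr{F}$ contains both arcs. The $H$-class digraph $C_{\mathscr{F}}(D)$ has vertex set $\mathscr{F}$, and $(F,G)$ (possibly $F=G$, a loop) is an arc iff there exist $(u,v)\in F$ and $(v,w)\in G$. $\mathscr{F}$ is walk-preservative if for every arc $(F,G)$ of $C_{\mathscr{F}}(D)$ and every $z\in V(D\langle F\rangle)$ there is a $zw$-path in $D\langle F\rangle$ for some $w\in V(D\langle G\rangle)$. A digraph is unilateral if for any two vertices $u,v$ there is a $uv$-path or a $vu$-path; a sink of a loopless digraph is a vertex with no out-going arc. For a digraph $G$ (possibly with loops) and $k\ge2$, $l\ge1$, a $(k,l)$-kernel is a set $S\subseteq V(G)$ such that every walk between two different vertices of $S$ has length at least $k$, and every vertex not in $S$ has a walk of length at most $l$ to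 a vertex of $S$. For a walk $W=(x_0,\ldots,x_n)$ in $D$, there is an obstruction on $x_i$ if $(\rho(x_{i-1},x_i),\rho(x_i,x_{i+1}))\notin A(H)$; for open $W$, $O_H(W)$ is the set of $i\in\{1,\dots,n-1\}$ with an obstruction on $x_i$ and $l_H(W)=|O_H(W)|+1$. A set $S\subseteq V(D)$ is a $(k,l,H)$-kernel by walks if every walk between two different vertices of $S$ has $H$-length at least $k$ and every $x\notin S$ has a walk to $S$ of $H$-length at most $l$. -}

module Defs where

open import Data.Nat using (ℕ; zero; suc; _+_; _≤_)
open import Data.Bool using (Bool; true; false; if_then_else_)
open import Data.Fin using (Fin)
open import Data.Fin.Subset using (Subset; _∈_; _∉_)
open import Data.List using (List; []; _∷_)
open import Data.List.Relation.Unary.Unique.Propositional using (Unique)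
open import Data.Product using (Σ; ∃; ∃-syntax; _×_; _,_)
open import Data.Sum using (_⊎_)
open import Relation.Binary.PropositionalEquality using (_≡_; _≢_)
open import Relation.Nullary using (¬_)

data Walk {V : Set} (R : V → V → Set) : V → V → ℕ → Set where
  []   : ∀ {x} → Walk R x x 0
  step : ∀ {x y z j} → R x y → Walk R y z j → Walk R x z (suc j)

verts : ∀ {V : Set} {R : V → V → Set} {x y j} → Walk R x y j → List V
verts {x = x} []           = x ∷ []
verts {x = x} (step _ w)   = x ∷ verts w

Path : ∀ {V : Set} (R : V → V → Set) → V → V → Set
Path R x y = ∃[ j ] Σ (Walk R x y j) (λ w → Unique (verts w))

IsKLKernel : ∀ {c} (R : Fin c → Fin c → Set) (k l : ℕ) (S : Subset c) → Set
IsKLKernel {c} R k l S =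
  (∀ (x y : Fin c) → x ∈ S → y ∈ S → x ≢ y →
     ∀ j → Walk R x y j → k ≤ j)
  × (∀ (x : Fin c) → x ∉ S →
       ∃[ y ] ∃[ j ] (y ∈ S × j ≤ l × Walk R x y j))

record HColoredDigraph (m : ℕ) : Set where
  field
    n        : ℕ
    adj      : Fin n → Fin n → Bool
    loopless : ∀ v → adj v v ≡ false
    ρ        : Fin n → Fin n → Fin m    -- colour of arc (u,v); only
                                        -- meaningful when adj u v ≡ true

  Arc : Fin n → Fin n → Set
  Arc u v = adj u v ≡ true

open HColoredDigraph public

module _ {m : ℕ} (Hadj : Fin m → Fin m → Bool) (D : HColoredDigraph m) where

  private
    N = n D

  obstructions : ∀ {x y j} → Walk (Arc D) x y j → ℕ
  obstructions [] = 0
  obstructions (step _ []) = 0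
  obstructions (step {x} {y} _ (step {y} {z} a w)) =
    (if Hadj (ρ D x y) (ρ D y z) then 0 else 1) + obstructions (step a w)

  -- H-length l_H(W) = |O_H(W)| + 1 (used for open walks)
  Hlength : ∀ {x y j} → Walk (Arc D) x y j → ℕ
  Hlength w = suc (obstructions w)

  IsKLHKernelByWalks : (k l : ℕ) → Subset N → Set
  IsKLHKernelByWalks k l S =
    (∀ (x y : Fin N) → x ∈ S → y ∈ S → x ≢ y →
       ∀ j (w : Walk (Arc D) x y j) → k ≤ Hlength w)
    × (∀ (x : Fin N) → x ∉ S →
         ∃[ y ] ∃[ j ] Σ (Walk (Arc D) x y j) (λ w → y ∈ S × Hlength w ≤ l))

  -- A partition of A(D) into c (nonempty) classes is given by a class
  -- map cls on arcs (values on non-arcs irrelevant) that hits every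
  -- class index.
  module _ {c : ℕ} (cls : Fin N → Fin N → Fin c) where

    ClassArc : Fin c → Fin N → Fin N → Set
    ClassArc i u v = Arc D u v × cls u v ≡ i

    InClass : Fin c → Fin N → Set
    InClass i z = ∃[ y ] (ClassArc i z y ⊎ ClassArc i y z)

    IsPartition : Set
    IsPartition = ∀ (i : Fin c) → ∃[ u ] ∃[ v ] ClassArc i u v

    IsHClassPartition : Set
    IsHClassPartition =
      IsPartition ×
      (∀ (u v w : Fin N) → Arc D u v → Arc D v w →
         (Hadj (ρ D u v) (ρ D v w) ≡ true → cls u v ≡ cls v w)
         × (cls u v ≡ cls v w → Hadj (ρ D u v) (ρ D v w) ≡ true))

    ClassDigraphArc : Fin c → Fin c → Set
    ClassDigraphArc i j =
      ∃[ u ] ∃[ v ] ∃[ w ] (ClassArc i u v × ClassArc j v w)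

    IsWalkPreservative : Set
    IsWalkPreservative =
      ∀ (i j : Fin c) → ClassDigraphArc i j →
        ∀ (z : Fin N) → InClass i z →
          ∃[ w ] (InClass j w × Path (ClassArc i) z w)

    ClassUnilateral : Fin c → Set
    ClassUnilateral i =
      ∀ (u v : Fin N) → InClass i u → InClass i v →
        Path (ClassArc i) u v ⊎ Path (ClassArc i) v u

    ClassNoSinks : Fin c → Set
    ClassNoSinks i = ∀ (u : Fin N) → InClass i u → ∃[ v ] ClassArc i u v

{-# OPTIONS --safe #-}
-- Every class F of the partition has a terminal vertex t(F): a vertex of
-- D⟨F⟩ reached from all of D⟨F⟩ (by unilaterality and finiteness), with an
-- incoming arc of F (no sinks).  The kernel by walks consists of the
-- isolated vertices of D together with the t(G), G in the (k,l)-kernel K.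
-- A walk of D with r obstructions, started after an arc of F and followed
-- by an arc of G, projects to a walk of length r + 2 from F to G in the
-- class digraph, which gives independence.  Conversely, walk-preservation
-- lifts a walk of length j in the class digraph to a walk of D with at most
-- j obstructions ending at a terminal vertex, which gives absorption.
module Submission where

open import Defs
open import Data.Nat using (ℕ; zero; suc; _+_; _∸_; _≤_; z≤n; s≤s)
open import Data.Nat.Properties using (≤-trans; ≤-refl; ≤-reflexive; n≤1+n; +-comm; ∸-monoˡ-≤)
open import Data.Bool using (Bool; true; false)
import Data.Bool.Properties as Bool
open import Data.Fin using (Fin)
import Data.Fin.Properties as Fin
open import Data.Fin.Subset using (Subset; _∈_; _∉_)
open import Data.Fin.Subset.Properties using (_∈?_)
open import Data.List using (List; []; _∷_; allFin)
open import Data.List.Relation.Unary.All as All using (All; []; _∷_)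
open import Data.List.Membership.Propositional.Properties using (∈-allFin)
open import Data.Product using (Σ; ∃; ∃-syntax; _×_; _,_; proj₁; proj₂)
open import Data.Sum as Sum using (_⊎_; inj₁; inj₂)
open import Data.Empty using (⊥-elim)
open import Data.Vec using (tabulate)
open import Data.Vec.Properties using (lookup∘tabulate; []=⇒lookup; lookup⇒[]=)
open import Function using (_∘_)
open import Relation.Binary.PropositionalEquality using (_≡_; _≢_; refl; sym; trans; subst)
open import Relation.Nullary using (¬_; Dec; yes; no; does)
open import Relation.Nullary.Decidable using (dec-true; _×-dec_; _⊎-dec_; ¬?)
open import Relation.Unary using (Decidable)

module _ {V : Set} {R : V → V → Set} where

  _++ʷ_ : ∀ {x y z i j} → Walk R x y i → Walk R y z j → Walk R x z (i + j)
  []       ++ʷ w = w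
  step a v ++ʷ w = step a (v ++ʷ w)

  last-arc : ∀ {x y j} → Walk R x y (suc j) → ∃[ p ] R p y
  last-arc (step a [])         = _ , a
  last-arc (step _ (step b w)) = last-arc (step b w)

mapʷ : ∀ {V : Set} {R S : V → V → Set} → (∀ {a b} → R a b → S a b) →
       ∀ {x y j} → Walk R x y j → Walk S x y j
mapʷ f []         = []
mapʷ f (step a w) = step (f a) (mapʷ f w)

Reachable : ∀ {V : Set} → (V → V → Set) → V → V → Set
Reachable R x y = ∃[ j ] Walk R x y j

path⇒reachable : ∀ {V : Set} {R : V → V → Set} {x y} → Path R x y → Reachable R x y
path⇒reachable (j , w , _) = j , w

reached-from-successor⇒in-arc : ∀ {V : Set} {R : V → V → Set} → (∀ {x} → ¬ R x x) →
  ∀ {t s} → R t s → Reachable R s t → ∃[ p ] R p t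
reached-from-successor⇒in-arc irreflexive t→s (zero , [])  = ⊥-elim (irreflexive t→s)
reached-from-successor⇒in-arc irreflexive t→s (suc _ , w) = last-arc w

module _ {N : ℕ} {R : Fin N → Fin N → Set} {P : Fin N → Set} (P? : Decidable P)
  (unilateral : ∀ u v → P u → P v → Reachable R u v ⊎ Reachable R v u) where

  private
    terminal-vertex-of-list : (xs : List (Fin N)) → ∃ P →
      ∃[ t ] P t × All (λ u → P u → Reachable R u t) xs
    terminal-vertex-of-list []       (t , Pt) = t , Pt , []
    terminal-vertex-of-list (u ∷ xs) ∃P with terminal-vertex-of-list xs ∃P
    ... | t , Pt , reach with P? u
    ...   | no ¬Pu = t , Pt , (λ Pu → ⊥-elim (¬Pu Pu)) ∷ reach
    ...   | yes Pu with unilateral t u Pt Pu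
    ...     | inj₂ u→t = t , Pt , (λ _ → u→t) ∷ reach
    ...     | inj₁ (j , t→u) = u , Pu , (λ _ → 0 , []) ∷ All.map (λ r Pv → extend (r Pv)) reach
      where
      extend : ∀ {v} → Reachable R v t → Reachable R v u
      extend (i , v→t) = i + j , v→t ++ʷ t→u

  unilateral⇒terminal-vertex : ∃ P → ∃[ t ] P t × (∀ u → P u → Reachable R u t)
  unilateral⇒terminal-vertex ∃P with terminal-vertex-of-list (allFin N) ∃P
  ... | t , Pt , reach = t , Pt , λ u → All.lookup reach (∈-allFin u)

toSubset : ∀ {N} {P : Fin N → Set} → Decidable P → Subset N
toSubset P? = tabulate (does ∘ P?)

module _ {N} {P : Fin N → Set} (P? : Decidable P) where

  ∈-toSubset⁺ : ∀ {x} → P x → x ∈ toSubset P?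
  ∈-toSubset⁺ {x} Px = lookup⇒[]= x _ (trans (lookup∘tabulate _ x) (dec-true (P? x) Px))

  ∈-toSubset⁻ : ∀ {x} → x ∈ toSubset P? → P x
  ∈-toSubset⁻ {x} x∈ with P? x | trans (sym (lookup∘tabulate _ x)) ([]=⇒lookup x∈)
  ... | yes Px | _ = Px
  ... | no _   | ()

module HClasses {m : ℕ} (Hadj : Fin m → Fin m → Bool) (D : HColoredDigraph m)
  {c : ℕ} (cls : Fin (n D) → Fin (n D) → Fin c) where

  forget : ∀ {i x y j} → Walk (ClassArc Hadj D cls i) x y j → Walk (Arc D) x y j
  forget = mapʷ proj₁

  classArc? : ∀ i u v → Dec (ClassArc Hadj D cls i u v)
  classArc? i u v = (adj D u v Bool.≟ true) ×-dec (cls u v Fin.≟ i)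

  inClass? : ∀ i → Decidable (InClass Hadj D cls i)
  inClass? i z = Fin.any? (λ y → classArc? i z y ⊎-dec classArc? i y z)

  classArc-irreflexive : ∀ {i x} → ¬ ClassArc Hadj D cls i x x
  classArc-irreflexive {x = x} (a , _) with trans (sym a) (loopless D x)
  ... | ()

  obstructions-step-≤ : ∀ {u v x j} (a : Arc D u v) (w : Walk (Arc D) v x j) →
    obstructions Hadj D (step a w) ≤ suc (obstructions Hadj D w)
  obstructions-step-≤ a [] = z≤n
  obstructions-step-≤ {u} {v} a (step {y = w} b ws) with Hadj (ρ D u v) (ρ D v w)
  ... | true  = n≤1+n _
  ... | false = ≤-refl

  module _ (partition : IsHClassPartition Hadj D cls) where

    same-class⇒H-adjacent : ∀ {u v w} → Arc D u v → Arc D v w →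
      cls u v ≡ cls v w → Hadj (ρ D u v) (ρ D v w) ≡ true
    same-class⇒H-adjacent a b = proj₂ (proj₂ partition _ _ _ a b)

    H-adjacent⇒same-class : ∀ {u v w} → Arc D u v → Arc D v w →
      Hadj (ρ D u v) (ρ D v w) ≡ true → cls u v ≡ cls v w
    H-adjacent⇒same-class a b = proj₁ (proj₂ partition _ _ _ a b)

    obstructions-step-same-class : ∀ {i u v w x j}
      (a : ClassArc Hadj D cls i u v) (b : ClassArc Hadj D cls i v w) (ws : Walk (Arc D) w x j) →
      obstructions Hadj D (step (proj₁ a) (step (proj₁ b) ws))
        ≡ obstructions Hadj D (step (proj₁ b) ws)
    obstructions-step-same-class (a , refl) (b , cls≡) ws
      rewrite same-class⇒H-adjacent a b (sym cls≡) = refl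

    obstructions-classWalk : ∀ {i x y j} (s : Walk (ClassArc Hadj D cls i) x y j) →
      obstructions Hadj D (forget s) ≡ 0
    obstructions-classWalk []                = refl
    obstructions-classWalk (step a [])       = refl
    obstructions-classWalk (step a (step b s)) =
      trans (obstructions-step-same-class a b (forget s)) (obstructions-classWalk (step b s))

    obstructions-classWalk-++ : ∀ {i x y z j j′}
      (s : Walk (ClassArc Hadj D cls i) x y j) (w : Walk (Arc D) y z j′) →
      obstructions Hadj D (forget s ++ʷ w) ≤ suc (obstructions Hadj D w)
    obstructions-classWalk-++ []                  w = n≤1+n _
    obstructions-classWalk-++ (step a [])         w = obstructions-step-≤ (proj₁ a) w
    obstructions-classWalk-++ (step a (step b s)) w =
      subst (_≤ _) (sym (obstructions-step-same-class a b (forget s ++ʷ w)))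
        (obstructions-classWalk-++ (step b s) w)

    -- Each obstruction of the walk is a change of class, i.e. one more arc of C_F(D).
    project : ∀ {u v x t i j} (a : Arc D u v) (w : Walk (Arc D) v x j) → ClassArc Hadj D cls i x t →
      Walk (ClassDigraphArc Hadj D cls) (cls u v) i (suc (obstructions Hadj D (step a w)))
    project {u} {v} a [] x→t = step (u , v , _ , (a , refl) , x→t) []
    project {u} {v} a (step {y = y} b w) x→t with Hadj (ρ D u v) (ρ D v y) in adjacent
    ... | true  = subst (λ F → Walk (ClassDigraphArc Hadj D cls) F _ _)
                    (sym (H-adjacent⇒same-class a b adjacent)) (project b w x→t)
    ... | false = step (u , v , y , (a , refl) , (b , refl)) (project b w x→t)

    module Terminal (preservative : IsWalkPreservative Hadj D cls)
      (classes : ∀ i → ClassUnilateral Hadj D cls i × ClassNoSinks Hadj D cls i) where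

      terminal : ∀ i → ∃[ t ] InClass Hadj D cls i t ×
        (∀ u → InClass Hadj D cls i u → Reachable (ClassArc Hadj D cls i) u t)
      terminal i = unilateral⇒terminal-vertex (inClass? i)
        (λ u v u∈ v∈ → Sum.map path⇒reachable path⇒reachable (proj₁ (classes i) u v u∈ v∈))
        class-nonempty
        where
        class-nonempty : ∃ (InClass Hadj D cls i)
        class-nonempty with proj₁ partition i
        ... | u , v , u→v = v , u , inj₂ u→v

      top : Fin c → Fin (n D)
      top i = proj₁ (terminal i)

      top∈class : ∀ i → InClass Hadj D cls i (top i)
      top∈class i = proj₁ (proj₂ (terminal i))

      reaches-top : ∀ i u → InClass Hadj D cls i u → Reachable (ClassArc Hadj D cls i) u (top i)
      reaches-top i = proj₂ (proj₂ (terminal i))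

      top-out-arc : ∀ i → ∃[ s ] ClassArc Hadj D cls i (top i) s
      top-out-arc i = proj₂ (classes i) (top i) (top∈class i)

      top-in-arc : ∀ i → ∃[ p ] ClassArc Hadj D cls i p (top i)
      top-in-arc i with top-out-arc i
      ... | s , top→s = reached-from-successor⇒in-arc classArc-irreflexive top→s
                          (reaches-top i s (top i , inj₂ top→s))

      lift-to-top : ∀ {F G j} → Walk (ClassDigraphArc Hadj D cls) F G j →
        ∀ {z} → InClass Hadj D cls F z →
        ∃[ j′ ] Σ (Walk (Arc D) z (top G) j′) (λ w → obstructions Hadj D w ≤ j)
      lift-to-top {F} [] z∈F with reaches-top F _ z∈F
      ... | _ , s = _ , forget s , ≤-reflexive (obstructions-classWalk s)
      lift-to-top {F} (step F→F′ cw) {z} z∈F with preservative F _ F→F′ z z∈F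
      ... | w , w∈F′ , (_ , p , _) with lift-to-top cw w∈F′
      ... | _ , r , r-obs = _ , forget p ++ʷ r , ≤-trans (obstructions-classWalk-++ p r) (s≤s r-obs)

      module Kernel {k l : ℕ} (K : Subset c)
        (K-kernel : IsKLKernel (ClassDigraphArc Hadj D cls) k l K) where

        NonIsolated : Fin (n D) → Set
        NonIsolated x = ∃[ y ] (Arc D x y ⊎ Arc D y x)

        nonIsolated? : Decidable NonIsolated
        nonIsolated? x = Fin.any? (λ y → (adj D x y Bool.≟ true) ⊎-dec (adj D y x Bool.≟ true))

        InKernel : Fin (n D) → Set
        InKernel x = ¬ NonIsolated x ⊎ ∃[ G ] (G ∈ K × top G ≡ x)

        inKernel? : Decidable InKernel
        inKernel? x = ¬? (nonIsolated? x) ⊎-dec Fin.any? (λ G → (G ∈? K) ×-dec (top G Fin.≟ x))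

        S : Subset (n D)
        S = toSubset inKernel?

        Hlength-between-tops : ∀ {F G j} → F ∈ K → G ∈ K → F ≢ G →
          (w : Walk (Arc D) (top F) (top G) (suc j)) → k ∸ 1 ≤ Hlength Hadj D w
        Hlength-between-tops {F} {G} F∈K G∈K F≢G (step {y = v} a w)
          with top-in-arc F | top-out-arc G
        ... | p , p→top | t , top→t =
          ∸-monoˡ-≤ 1 (proj₁ K-kernel F G F∈K G∈K F≢G _
            (step (p , top F , v , p→top , (a , refl)) (project a w top→t)))

        Hlength-in-kernel : ∀ {x y j} → InKernel x → InKernel y → x ≢ y →
          (w : Walk (Arc D) x y j) → k ∸ 1 ≤ Hlength Hadj D w
        Hlength-in-kernel _ _ x≢y [] = ⊥-elim (x≢y refl)
        Hlength-in-kernel (inj₁ isolated) _ _ (step a _) = ⊥-elim (isolated (_ , inj₁ a))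
        Hlength-in-kernel _ (inj₁ isolated) _ w@(step _ _) =
          ⊥-elim (isolated (proj₁ (last-arc w) , inj₂ (proj₂ (last-arc w))))
        Hlength-in-kernel (inj₂ (F , F∈K , refl)) (inj₂ (G , G∈K , refl)) x≢y w@(step _ _) =
          Hlength-between-tops F∈K G∈K (λ { refl → x≢y refl }) w

        independent : ∀ x y → x ∈ S → y ∈ S → x ≢ y →
          ∀ j (w : Walk (Arc D) x y j) → k ∸ 1 ≤ Hlength Hadj D w
        independent x y x∈S y∈S x≢y _ =
          Hlength-in-kernel (∈-toSubset⁻ inKernel? x∈S) (∈-toSubset⁻ inKernel? y∈S) x≢y

        walk-into-K : ∀ F →
          ∃[ G ] ∃[ j ] (G ∈ K × j ≤ l × Walk (ClassDigraphArc Hadj D cls) F G j)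
        walk-into-K F with F ∈? K
        ... | yes F∈K = F , 0 , F∈K , z≤n , []
        ... | no  F∉K = proj₂ K-kernel F F∉K

        absorbed-from-class : ∀ {F x} → InClass Hadj D cls F x →
          ∃[ y ] ∃[ j ] Σ (Walk (Arc D) x y j) (λ w → y ∈ S × Hlength Hadj D w ≤ l + 1)
        absorbed-from-class {F} x∈F with walk-into-K F
        ... | G , _ , G∈K , j≤l , cw with lift-to-top cw x∈F
        ... | _ , w , w-obs =
          top G , _ , w , ∈-toSubset⁺ inKernel? (inj₂ (G , G∈K , refl)) ,
          ≤-trans (s≤s (≤-trans w-obs j≤l)) (≤-reflexive (+-comm 1 l))

        absorbent : ∀ x → x ∉ S →
          ∃[ y ] ∃[ j ] Σ (Walk (Arc D) x y j) (λ w → y ∈ S × Hlength Hadj D w ≤ l + 1)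
        absorbent x x∉S with nonIsolated? x
        ... | no  isolated     = ⊥-elim (x∉S (∈-toSubset⁺ inKernel? (inj₁ isolated)))
        ... | yes (y , inj₁ a) = absorbed-from-class (y , inj₁ (a , refl))
        ... | yes (y , inj₂ a) = absorbed-from-class (y , inj₂ (a , refl))

theorem7 : (m : ℕ) (Hadj : Fin m → Fin m → Bool) (D : HColoredDigraph m)
    (c : ℕ) (cls : Fin (n D) → Fin (n D) → Fin c) →
    IsHClassPartition Hadj D cls →
    IsWalkPreservative Hadj D cls →
    (∀ (i : Fin c) → ClassUnilateral Hadj D cls i × ClassNoSinks Hadj D cls i) →
    (k l : ℕ) → 3 ≤ k → 1 ≤ l →
    (K : Subset c) → IsKLKernel (ClassDigraphArc Hadj D cls) k l K →
    ∃[ S ] IsKLHKernelByWalks Hadj D (k ∸ 1) (l + 1) S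
theorem7 m Hadj D c cls partition preservative classes k l _ _ K K-kernel =
  S , independent , absorbent
  where open HClasses.Terminal Hadj D cls partition preservative classes
        open Kernel K K-kernel
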